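{- Let $C=x_0,x_1,\ldots,x_{n-1},x_0$ be a cycle of length $n\neq 5$, and let $f$ be a partial proper edge coloring of three edges of $C$ with colors from a set of three colors. If at least two of the three colored edges are adjacent, then $f$ can be extended to a 3-star edge coloring of $C$.
   Context: A $3$-star edge coloring of a graph is a proper edge coloring using at most $3$ colors such that no path and no cycle with four edges is bicolored (i.e. colored with only two colors). A partial edge coloring assigns colors to some of the edges; an extension is a coloring of all edges agreeing with it on the colored edges. -}

module Defs where

open import Data.Nat using (ℕ; zero; suc; _∸_)
open import Data.Fin using (Fin; toℕ)
open import Data.Product using (_×_; Σ; ∃; ∃-syntax)
open import Data.Sum using (_⊎_)
open import Data.Empty using (⊥)
open import Relation.Binary.PropositionalEquality using (_≡_; _≢_)

-- The cycle C = x_0, x_1, ..., x_{n-1}, x_0 has vertex set Fin n.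
-- Edge number i (i : Fin n) is the edge x_i x_{i+1 mod n}.

Succ : (n : ℕ) → Fin n → Fin n → Set
Succ n i j = (toℕ j ≡ suc (toℕ i)) ⊎ ((toℕ i ≡ n ∸ 1) × (toℕ j ≡ 0))

EdgeOf : (n : ℕ) → Fin n → Fin n → Fin n → Set
EdgeOf n v w e = (Succ n v w × e ≡ v) ⊎ (Succ n w v × e ≡ w)

AdjEdges : (n : ℕ) → Fin n → Fin n → Set
AdjEdges n e e' = Succ n e e' ⊎ Succ n e' e

Colour : Set
Colour = Fin 3

EdgeColouring : ℕ → Set
EdgeColouring n = Fin n → Colour

Proper : (n : ℕ) → EdgeColouring n → Set
Proper n c = ∀ e e' → AdjEdges n e e' → c e ≢ c e'

InTwo : Colour → Colour → Colour → Set
InTwo a b k = (k ≡ a) ⊎ (k ≡ b)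

record Path4 (n : ℕ) : Set where
  field
    v0 v1 v2 v3 v4 : Fin n
    e1 e2 e3 e4 : Fin n
    d01 : v0 ≢ v1
    d02 : v0 ≢ v2
    d03 : v0 ≢ v3
    d04 : v0 ≢ v4
    d12 : v1 ≢ v2
    d13 : v1 ≢ v3
    d14 : v1 ≢ v4
    d23 : v2 ≢ v3
    d24 : v2 ≢ v4
    d34 : v3 ≢ v4
    s1 : EdgeOf n v0 v1 e1
    s2 : EdgeOf n v1 v2 e2
    s3 : EdgeOf n v2 v3 e3
    s4 : EdgeOf n v3 v4 e4

record Cycle4 (n : ℕ) : Set where
  field
    v0 v1 v2 v3 : Fin n
    e1 e2 e3 e4 : Fin n
    d01 : v0 ≢ v1
    d02 : v0 ≢ v2
    d03 : v0 ≢ v3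
    d12 : v1 ≢ v2
    d13 : v1 ≢ v3
    d23 : v2 ≢ v3
    s1 : EdgeOf n v0 v1 e1
    s2 : EdgeOf n v1 v2 e2
    s3 : EdgeOf n v2 v3 e3
    s4 : EdgeOf n v3 v0 e4

BicolouredPath : (n : ℕ) → EdgeColouring n → Path4 n → Set
BicolouredPath n c p = ∃[ a ] ∃[ b ]
  (InTwo a b (c e1) × InTwo a b (c e2) × InTwo a b (c e3) × InTwo a b (c e4))
  where open Path4 p

BicolouredCycle : (n : ℕ) → EdgeColouring n → Cycle4 n → Set
BicolouredCycle n c q = ∃[ a ] ∃[ b ]
  (InTwo a b (c e1) × InTwo a b (c e2) × InTwo a b (c e3) × InTwo a b (c e4))
  where open Cycle4 q

StarColouring3 : (n : ℕ) → EdgeColouring n → Set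
StarColouring3 n c =
  Proper n c
  × (∀ (p : Path4 n) → BicolouredPath n c p → ⊥)
  × (∀ (q : Cycle4 n) → BicolouredCycle n c q → ⊥)

module Submission where

-- Colour the cycle by a cyclic word over the three colours. Every path or cycle with four
-- edges in C_n runs along four consecutive edges, so the word gives a 3-star edge colouring
-- as soon as every window of four cyclically consecutive letters is properly coloured and
-- not of the form a b a b. Rotating the cycle, the two adjacent precoloured edges become
-- edges 0 and 1, coloured a and b, and the third one becomes edge p + 2, followed by q
-- further edges. Inserting a b c, where c is the third colour, in front of an occurrence of
-- a b only creates good windows, so a word for (p, q) yields words for (p + 3, q) and
-- (p, q + 3). This leaves the cases p, q < 6, which are settled by exhaustive search.

open import Defs
open import Data.Nat using (ℕ; zero; suc; _+_; _*_; _≤_; _<_; z≤n; s≤s)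
import Data.Nat.Properties as ℕ
open import Data.Fin using (Fin; toℕ; fromℕ; inject₁; #_) renaming (zero to fzero; suc to fsuc)
open import Data.Fin.Properties
  using (_≟_; all?; any?; toℕ-injective; toℕ<n; toℕ-fromℕ; toℕ-inject₁; inject₁-injective)
open import Data.List
  using (List; []; _∷_; _++_; _∷ʳ_; take; length; map; concatMap; filter; initLast; _∷ʳ′_)
open import Data.List.Properties using (++-assoc; ∷ʳ-++; length-++; length-take)
import Data.List.Relation.Unary.Any as Any
open import Data.Product using (_×_; Σ; ∃; ∃-syntax; _,_; proj₁; proj₂)
open import Data.Sum using (_⊎_; inj₁; inj₂; [_,_]′)
open import Data.Empty using (⊥; ⊥-elim)
open import Data.Unit using (⊤; tt)
open import Relation.Nullary using (¬_; Dec; yes)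
open import Relation.Nullary.Decidable using (_×-dec_; _→-dec_; ¬?; toWitness)
open import Relation.Binary.PropositionalEquality
  using (_≡_; _≢_; refl; sym; trans; cong; cong₂; subst; ≢-sym; module ≡-Reasoning)

-- Cyclic words with good windows

Good : Colour → Colour → Colour → Colour → Set
Good a b c d = a ≢ b × b ≢ c × c ≢ d × ¬ (a ≡ c × b ≡ d)

good? : ∀ a b c d → Dec (Good a b c d)
good? a b c d = ¬? (a ≟ b) ×-dec ¬? (b ≟ c) ×-dec ¬? (c ≟ d) ×-dec ¬? (a ≟ c ×-dec b ≟ d)

Good-cong : ∀ {a a′ b b′ c c′ d d′} →
  a ≡ a′ → b ≡ b′ → c ≡ c′ → d ≡ d′ → Good a b c d → Good a′ b′ c′ d′
Good-cong refl refl refl refl g = g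

StartsGood : Colour → List Colour → Set
StartsGood a (b ∷ c ∷ d ∷ _) = Good a b c d
StartsGood _ _               = ⊤

startsGood? : ∀ a xs → Dec (StartsGood a xs)
startsGood? a (b ∷ c ∷ d ∷ _) = good? a b c d
startsGood? a []              = yes tt
startsGood? a (_ ∷ [])        = yes tt
startsGood? a (_ ∷ _ ∷ [])    = yes tt

Windows : List Colour → Set
Windows []       = ⊤
Windows (x ∷ xs) = StartsGood x (take 3 xs) × Windows xs

windows? : ∀ xs → Dec (Windows xs)
windows? []       = yes tt
windows? (x ∷ xs) = startsGood? x (take 3 xs) ×-dec windows? xs

CyclicWindows : List Colour → Set
CyclicWindows w = Windows (w ++ take 3 w)

take-++-take : ∀ {A : Set} {m} n (xs ys : List A) → n ≤ m →
  take n (xs ++ ys) ≡ take n (xs ++ take m ys)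
take-++-take zero    xs       ys       _         = refl
take-++-take (suc n) []       []       (s≤s _)   = refl
take-++-take (suc n) []       (y ∷ ys) (s≤s n≤m) = cong (y ∷_) (take-++-take n [] ys n≤m)
take-++-take (suc n) (x ∷ xs) ys       n<m       = cong (x ∷_) (take-++-take n xs ys (ℕ.<⇒≤ n<m))

windows-take : ∀ ys → Windows (take 3 ys)
windows-take []              = tt
windows-take (_ ∷ [])        = tt , tt
windows-take (_ ∷ _ ∷ [])    = tt , tt , tt
windows-take (_ ∷ _ ∷ _ ∷ _) = tt , tt , tt , tt

windows-++⁺ : ∀ xs ys → Windows (xs ++ take 3 ys) → Windows ys → Windows (xs ++ ys)
windows-++⁺ []       ys _       w′ = w′
windows-++⁺ (x ∷ xs) ys (s , w) w′ =
  subst (StartsGood x) (sym (take-++-take 3 xs ys ℕ.≤-refl)) s , windows-++⁺ xs ys w w′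

windows-++⁻ : ∀ xs ys → Windows (xs ++ ys) → Windows (xs ++ take 3 ys)
windows-++⁻ []       ys _       = windows-take ys
windows-++⁻ (x ∷ xs) ys (s , w) =
  subst (StartsGood x) (take-++-take 3 xs ys ℕ.≤-refl) s , windows-++⁻ xs ys w

windows-++ʳ : ∀ xs ys → Windows (xs ++ ys) → Windows ys
windows-++ʳ []       ys w       = w
windows-++ʳ (x ∷ xs) ys (_ , w) = windows-++ʳ xs ys w

windows-replace-last : ∀ xs {x a b y c} ys → c ≢ a → c ≢ b →
  Windows (xs ++ x ∷ a ∷ b ∷ y ∷ ys) → Windows (xs ++ x ∷ a ∷ b ∷ c ∷ [])
windows-replace-last xs {x} {a} {b} {c = c} ys c≢a c≢b w =
  windows-++⁺ xs _ (windows-++⁻ xs _ w) (good , tt , tt , tt , tt)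
  where
  good : Good x a b c
  good with windows-++ʳ xs _ w
  ... | (x≢a , a≢b , _) , _ = x≢a , a≢b , ≢-sym c≢b , λ (_ , a≡c) → c≢a (sym a≡c)

¬cyclicWindows-ab : ∀ {a b} → ¬ CyclicWindows (a ∷ b ∷ [])
¬cyclicWindows-ab ((_ , _ , _ , ¬abab) , _) = ¬abab (refl , refl)

cyclic-rewrap : ∀ {a b c} u → c ≢ a → c ≢ b →
  CyclicWindows (a ∷ b ∷ u) → Windows (a ∷ b ∷ u ++ a ∷ b ∷ c ∷ [])
cyclic-rewrap {a} {b} u c≢a c≢b cyc with initLast u
... | []             = ⊥-elim (¬cyclicWindows-ab cyc)
... | [] ∷ʳ′ x       = windows-replace-last (a ∷ b ∷ []) [] c≢a c≢b cyc
... | (i ∷ is) ∷ʳ′ x =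
  subst Windows (cong (λ v → a ∷ b ∷ v) (sym (∷ʳ-++ (i ∷ is) x _)))
    (windows-replace-last (a ∷ b ∷ i ∷ is) [] c≢a c≢b
      (subst Windows (cong (λ v → a ∷ b ∷ v) (∷ʳ-++ (i ∷ is) x _)) cyc))

windows-block : ∀ {a b c y} → a ≢ b → c ≢ a → c ≢ b → b ≢ y →
  Windows (a ∷ b ∷ c ∷ a ∷ b ∷ y ∷ [])
windows-block a≢b c≢a c≢b b≢y =
  (a≢b , ≢-sym c≢b , c≢a , λ (a≡c , _) → c≢a (sym a≡c)) ,
  (≢-sym c≢b , c≢a , a≢b , λ (b≡a , _) → a≢b (sym b≡a)) ,
  (c≢a , a≢b , b≢y , λ (c≡b , _) → c≢b c≡b) ,
  tt , tt , tt , tt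

cyclic-proper-start : ∀ {a b y} u → CyclicWindows (a ∷ b ∷ y ∷ u) → a ≢ b × b ≢ y
cyclic-proper-start []      ((a≢b , b≢y , _) , _) = a≢b , b≢y
cyclic-proper-start (_ ∷ _) ((a≢b , b≢y , _) , _) = a≢b , b≢y

cyclic-insert-front : ∀ {a b c} u → c ≢ a → c ≢ b →
  CyclicWindows (a ∷ b ∷ u) → CyclicWindows (a ∷ b ∷ c ∷ a ∷ b ∷ u)
cyclic-insert-front []      _   _   cyc = ⊥-elim (¬cyclicWindows-ab cyc)
cyclic-insert-front (y ∷ u) c≢a c≢b cyc =
  let a≢b , b≢y = cyclic-proper-start u cyc in
  windows-++⁺ (_ ∷ _ ∷ _ ∷ []) _ (windows-block a≢b c≢a c≢b b≢y) (cyclic-rewrap (y ∷ u) c≢a c≢b cyc)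

cyclic-insert-back : ∀ {a b c} u → c ≢ a → c ≢ b →
  CyclicWindows (a ∷ b ∷ u) → CyclicWindows (a ∷ b ∷ u ++ a ∷ b ∷ c ∷ [])
cyclic-insert-back             []      _   _   cyc = ⊥-elim (¬cyclicWindows-ab cyc)
cyclic-insert-back {a} {b} {c} (y ∷ u) c≢a c≢b cyc =
  let a≢b , b≢y = cyclic-proper-start u cyc in
  subst Windows (cong (λ v → a ∷ b ∷ y ∷ v) (sym (++-assoc u (a ∷ b ∷ c ∷ []) (a ∷ b ∷ y ∷ []))))
    (windows-++⁺ (a ∷ b ∷ y ∷ u) _ (cyclic-rewrap (y ∷ u) c≢a c≢b cyc) (windows-block a≢b c≢a c≢b b≢y))

-- Out-of-range positions read as the junk colour # 0; nth is only used below the length.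
nth : List Colour → ℕ → Colour
nth []       _       = # 0
nth (x ∷ xs) zero    = x
nth (x ∷ xs) (suc i) = nth xs i

nth-++ˡ : ∀ xs ys {i} → i < length xs → nth (xs ++ ys) i ≡ nth xs i
nth-++ˡ (x ∷ xs) ys {zero}  _         = refl
nth-++ˡ (x ∷ xs) ys {suc i} (s≤s i<n) = nth-++ˡ xs ys i<n

nth-++ʳ : ∀ xs ys i → nth (xs ++ ys) (length xs + i) ≡ nth ys i
nth-++ʳ []       ys i = refl
nth-++ʳ (x ∷ xs) ys i = nth-++ʳ xs ys i

nth-take : ∀ {k} xs {i} → i < k → nth (take k xs) i ≡ nth xs i
nth-take []       (s≤s _)           = refl
nth-take (x ∷ xs) {zero}  (s≤s _)   = refl
nth-take (x ∷ xs) {suc i} (s≤s i<k) = nth-take xs i<k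

windows-nth : ∀ xs t → Windows xs → t + 3 < length xs →
  Good (nth xs t) (nth xs (t + 1)) (nth xs (t + 2)) (nth xs (t + 3))
windows-nth (_ ∷ _ ∷ _ ∷ _ ∷ _) zero    (g , _)  _                    = g
windows-nth (_ ∷ _ ∷ _ ∷ [])    zero    _        (s≤s (s≤s (s≤s ())))
windows-nth (_ ∷ _ ∷ [])        zero    _        (s≤s (s≤s ()))
windows-nth (_ ∷ [])            zero    _        (s≤s ())
windows-nth (_ ∷ xs)            (suc t) (_ , ws) (s≤s t+3<n)          = windows-nth xs t ws t+3<n

-- Words with prescribed colours

third : ∀ (a b : Colour) → ∃[ c ] c ≢ a × c ≢ b
third = toWitness {a? = all? λ a → all? λ b → any? λ c → ¬? (c ≟ a) ×-dec ¬? (c ≟ b)} tt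

-- The cyclic word a b u₀ … u_{p+q}: p letters between b and u_p = k, and q letters after it.
Fits : Colour → Colour → ℕ → ℕ → Colour → List Colour → Set
Fits a b p q k u = length u ≡ suc (p + q) × CyclicWindows (a ∷ b ∷ u) × nth u p ≡ k

fits? : ∀ a b p q k u → Dec (Fits a b p q k u)
fits? a b p q k u = length u ℕ.≟ suc (p + q) ×-dec windows? _ ×-dec nth u p ≟ k

StarWord : Colour → Colour → ℕ → ℕ → Colour → Set
StarWord a b p q k = ∃ (Fits a b p q k)

grow-front : ∀ {a b p q k} → StarWord a b p q k → StarWord a b (3 + p) q k
grow-front {a} {b} (u , length≡ , cyc , at-p) =
  let c , c≢a , c≢b = third a b in
  c ∷ a ∷ b ∷ u , cong (3 +_) length≡ , cyclic-insert-front u c≢a c≢b cyc , at-p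

grow-back : ∀ {a b p q k} → StarWord a b p q k → StarWord a b p (3 + q) k
grow-back {a} {b} {p} {q} (u , length≡ , cyc , at-p) =
  let c , c≢a , c≢b = third a b in
  u ++ a ∷ b ∷ c ∷ [] , length-grows , cyclic-insert-back u c≢a c≢b cyc ,
  trans (nth-++ˡ u _ (subst (p <_) (sym length≡) (s≤s (ℕ.m≤m+n p q)))) at-p
  where
  open ≡-Reasoning
  length-grows : ∀ {v} → length (u ++ v) ≡ suc (p + (length v + q))
  length-grows {v} = begin
    length (u ++ v)            ≡⟨ length-++ u ⟩
    length u + length v        ≡⟨ cong (_+ length v) length≡ ⟩
    suc (p + q + length v)     ≡⟨ cong suc (ℕ.+-assoc p q (length v)) ⟩
    suc (p + (q + length v))   ≡⟨ cong (λ m → suc (p + m)) (ℕ.+-comm q (length v)) ⟩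
    suc (p + (length v + q))   ∎

grow-front* : ∀ {a b p q k} m → StarWord a b p q k → StarWord a b (m * 3 + p) q k
grow-front* zero    w = w
grow-front* (suc m) w = grow-front (grow-front* m w)

grow-back* : ∀ {a b p q k} m → StarWord a b p q k → StarWord a b p (m * 3 + q) k
grow-back* zero    w = w
grow-back* (suc m) w = grow-back (grow-back* m w)

Feasible : Colour → Colour → ℕ → ℕ → Colour → Set
Feasible a b p q k = a ≢ b × p + q ≢ 2 × (p ≡ 0 → k ≢ b) × (q ≡ 0 → k ≢ a)

feasible? : ∀ a b p q k → Dec (Feasible a b p q k)
feasible? a b p q k =
  ¬? (a ≟ b) ×-dec ¬? (p + q ℕ.≟ 2) ×-dec
  (p ℕ.≟ 0 →-dec ¬? (k ≟ b)) ×-dec (q ℕ.≟ 0 →-dec ¬? (k ≟ a))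

-- Only prunes the search space: small-star-word re-checks every candidate with fits?.
candidates : Colour → Colour → ℕ → List (List Colour)
candidates a b zero    = [] ∷ []
candidates a b (suc m) =
  filter (λ u → windows? (a ∷ b ∷ u))
    (concatMap (λ u → map (u ∷ʳ_) (# 0 ∷ # 1 ∷ # 2 ∷ [])) (candidates a b m))

small-star-word : ∀ a b (r s : Fin 6) k →
  Feasible a b (toℕ r) (toℕ s) k → StarWord a b (toℕ r) (toℕ s) k
small-star-word a b r s k feasible = Any.satisfied (search a b r s k feasible)
  where
  search : ∀ a b (r s : Fin 6) k → Feasible a b (toℕ r) (toℕ s) k →
    Any.Any (Fits a b (toℕ r) (toℕ s) k) (candidates a b (suc (toℕ r + toℕ s)))
  search = toWitness {a? = all? λ a → all? λ b → all? λ r → all? λ s → all? λ k →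
    feasible? a b (toℕ r) (toℕ s) k →-dec
    Any.any? (fits? a b (toℕ r) (toℕ s) k) (candidates a b (suc (toℕ r + toℕ s)))} tt

residue : ∀ p → ∃[ r ] ∃[ m ] p ≡ m * 3 + toℕ {6} r × (p ≡ toℕ r ⊎ 3 ≤ toℕ r)
residue 0 = # 0 , 0 , refl , inj₁ refl
residue 1 = # 1 , 0 , refl , inj₁ refl
residue 2 = # 2 , 0 , refl , inj₁ refl
residue 3 = # 3 , 0 , refl , inj₁ refl
residue 4 = # 4 , 0 , refl , inj₁ refl
residue 5 = # 5 , 0 , refl , inj₁ refl
residue (suc (suc (suc p@(suc (suc (suc _)))))) =
  let r , m , p≡ , p≡r⊎3≤r = residue p in
  r , suc m , cong (3 +_) p≡ ,
  inj₂ ([ (λ p≡r → subst (3 ≤_) p≡r (s≤s (s≤s (s≤s z≤n)))) , (λ 3≤r → 3≤r) ]′ p≡r⊎3≤r)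

residue-feasible : ∀ {a b p q r s k} → p ≡ r ⊎ 3 ≤ r → q ≡ s ⊎ 3 ≤ s →
  Feasible a b p q k → Feasible a b r s k
residue-feasible {a} {b} {p} {q} {r} {s} {k} p≡r⊎3≤r q≡s⊎3≤s (a≢b , p+q≢2 , p≡0⇒ , q≡0⇒) =
  a≢b , r+s≢2 p≡r⊎3≤r q≡s⊎3≤s , r≡0⇒ p≡r⊎3≤r , s≡0⇒ q≡s⊎3≤s
  where
  r+s≢2 : p ≡ r ⊎ 3 ≤ r → q ≡ s ⊎ 3 ≤ s → r + s ≢ 2
  r+s≢2 (inj₁ refl) (inj₁ refl)       = p+q≢2
  r+s≢2 (inj₂ 3≤r)  _           r+s≡2 = ℕ.<⇒≱ 3≤r (subst (r ≤_) r+s≡2 (ℕ.m≤m+n r s))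
  r+s≢2 (inj₁ _)    (inj₂ 3≤s)  r+s≡2 = ℕ.<⇒≱ 3≤s (subst (s ≤_) r+s≡2 (ℕ.m≤n+m s r))
  r≡0⇒ : p ≡ r ⊎ 3 ≤ r → r ≡ 0 → k ≢ b
  r≡0⇒ (inj₁ refl)      = p≡0⇒
  r≡0⇒ (inj₂ 3≤r)  refl = ⊥-elim (ℕ.<⇒≱ 3≤r z≤n)
  s≡0⇒ : q ≡ s ⊎ 3 ≤ s → s ≡ 0 → k ≢ a
  s≡0⇒ (inj₁ refl)      = q≡0⇒
  s≡0⇒ (inj₂ 3≤s)  refl = ⊥-elim (ℕ.<⇒≱ 3≤s z≤n)

star-word : ∀ {a b p q k} → Feasible a b p q k → StarWord a b p q k
star-word {a} {b} {p} {q} {k} feasible with residue p | residue q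
... | r , m , refl , p≡r⊎3≤r | s , m′ , refl , q≡s⊎3≤s =
  grow-front* m (grow-back* m′ (small-star-word a b r s k (residue-feasible p≡r⊎3≤r q≡s⊎3≤s feasible)))

-- Locally star colourings of the cycle

module _ {N : ℕ} where

  private
    not-above : (b : Fin (suc N)) → toℕ b ≢ suc N
    not-above b b≡1+N = ℕ.<-irrefl b≡1+N (toℕ<n b)

  succ-functional : ∀ {a b c : Fin (suc N)} → Succ (suc N) a b → Succ (suc N) a c → b ≡ c
  succ-functional         (inj₁ b≡)        (inj₁ c≡)        = toℕ-injective (trans b≡ (sym c≡))
  succ-functional {b = b} (inj₁ b≡)        (inj₂ (a≡N , _)) = ⊥-elim (not-above b (trans b≡ (cong suc a≡N)))
  succ-functional {c = c} (inj₂ (a≡N , _)) (inj₁ c≡)        = ⊥-elim (not-above c (trans c≡ (cong suc a≡N)))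
  succ-functional         (inj₂ (_ , b≡0)) (inj₂ (_ , c≡0)) = toℕ-injective (trans b≡0 (sym c≡0))

  succ-injective : ∀ {a b c : Fin (suc N)} → Succ (suc N) a c → Succ (suc N) b c → a ≡ b
  succ-injective (inj₁ c≡)        (inj₁ c≡′)       = toℕ-injective (ℕ.suc-injective (trans (sym c≡) c≡′))
  succ-injective (inj₁ c≡)        (inj₂ (_ , c≡0)) with () ← trans (sym c≡0) c≡
  succ-injective (inj₂ (_ , c≡0)) (inj₁ c≡)        with () ← trans (sym c≡0) c≡
  succ-injective (inj₂ (a≡N , _)) (inj₂ (b≡N , _)) = toℕ-injective (trans a≡N (sym b≡N))

  Run : Fin (suc N) → Fin (suc N) → Fin (suc N) → Fin (suc N) → Set
  Run i j k l = Succ (suc N) i j × Succ (suc N) j k × Succ (suc N) k l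

  straight-walk : ∀ {v₀ v₁ v₂ v₃ v₄ e₁ e₂ e₃ e₄} →
    EdgeOf (suc N) v₀ v₁ e₁ → EdgeOf (suc N) v₁ v₂ e₂ →
    EdgeOf (suc N) v₂ v₃ e₃ → EdgeOf (suc N) v₃ v₄ e₄ →
    v₀ ≢ v₂ → v₁ ≢ v₃ → v₂ ≢ v₄ → Run e₁ e₂ e₃ e₄ ⊎ Run e₄ e₃ e₂ e₁
  straight-walk (inj₁ (s₀₁ , _)) (inj₂ (s₂₁ , _)) _ _ d₀₂ _ _ =
    ⊥-elim (d₀₂ (succ-injective s₀₁ s₂₁))
  straight-walk (inj₁ _) (inj₁ (s₁₂ , _)) (inj₂ (s₃₂ , _)) _ _ d₁₃ _ =
    ⊥-elim (d₁₃ (succ-injective s₁₂ s₃₂))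
  straight-walk (inj₁ _) (inj₁ _) (inj₁ (s₂₃ , _)) (inj₂ (s₄₃ , _)) _ _ d₂₄ =
    ⊥-elim (d₂₄ (succ-injective s₂₃ s₄₃))
  straight-walk (inj₁ (s₀₁ , refl)) (inj₁ (s₁₂ , refl)) (inj₁ (s₂₃ , refl)) (inj₁ (_ , refl)) _ _ _ =
    inj₁ (s₀₁ , s₁₂ , s₂₃)
  straight-walk (inj₂ (s₁₀ , _)) (inj₁ (s₁₂ , _)) _ _ d₀₂ _ _ =
    ⊥-elim (d₀₂ (succ-functional s₁₀ s₁₂))
  straight-walk (inj₂ _) (inj₂ (s₂₁ , _)) (inj₁ (s₂₃ , _)) _ _ d₁₃ _ =
    ⊥-elim (d₁₃ (succ-functional s₂₁ s₂₃))
  straight-walk (inj₂ _) (inj₂ _) (inj₂ (s₃₂ , _)) (inj₁ (s₃₄ , _)) _ _ d₂₄ =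
    ⊥-elim (d₂₄ (succ-functional s₃₂ s₃₄))
  straight-walk (inj₂ (_ , refl)) (inj₂ (s₂₁ , refl)) (inj₂ (s₃₂ , refl)) (inj₂ (s₄₃ , refl)) _ _ _ =
    inj₂ (s₄₃ , s₃₂ , s₂₁)

alternate : ∀ {a b x y z : Colour} → InTwo a b x → InTwo a b y → InTwo a b z → x ≢ y → y ≢ z → x ≡ z
alternate (inj₁ refl) (inj₁ refl) _           x≢y _   = ⊥-elim (x≢y refl)
alternate (inj₁ refl) (inj₂ refl) (inj₁ refl) _   _   = refl
alternate (inj₁ refl) (inj₂ refl) (inj₂ refl) _   y≢z = ⊥-elim (y≢z refl)
alternate (inj₂ refl) (inj₁ refl) (inj₁ refl) _   y≢z = ⊥-elim (y≢z refl)
alternate (inj₂ refl) (inj₁ refl) (inj₂ refl) _   _   = refl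
alternate (inj₂ refl) (inj₂ refl) _           x≢y _   = ⊥-elim (x≢y refl)

record LocallyStar (n : ℕ) (c : EdgeColouring n) : Set where
  field
    proper  : ∀ {i j} → Succ n i j → c i ≢ c j
    no-abab : ∀ {i j k l} → Succ n i j → Succ n j k → Succ n k l → c i ≡ c k → c j ≢ c l

locallyStar-∘ : ∀ {n c} (f : Fin n → Fin n) → (∀ {i j} → Succ n i j → Succ n (f i) (f j)) →
  LocallyStar n c → LocallyStar n (λ i → c (f i))
locallyStar-∘ f f-succ star = record
  { proper  = λ s → proper (f-succ s)
  ; no-abab = λ s₁ s₂ s₃ → no-abab (f-succ s₁) (f-succ s₂) (f-succ s₃)
  }
  where open LocallyStar star

module _ {N : ℕ} {c : EdgeColouring (suc N)} (star : LocallyStar (suc N) c) where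
  open LocallyStar star

  no-bicoloured-run : ∀ {a b i j k l} → Run i j k l →
    InTwo a b (c i) → InTwo a b (c j) → InTwo a b (c k) → InTwo a b (c l) → ⊥
  no-bicoloured-run (sij , sjk , skl) ci cj ck cl =
    no-abab sij sjk skl (alternate ci cj ck (proper sij) (proper sjk))
                        (alternate cj ck cl (proper sjk) (proper skl))

  locallyStar⇒star : StarColouring3 (suc N) c
  locallyStar⇒star = adjacent-proper , no-path , no-cycle
    where
    adjacent-proper : ∀ e e′ → AdjEdges (suc N) e e′ → c e ≢ c e′
    adjacent-proper _ _ (inj₁ s) = proper s
    adjacent-proper _ _ (inj₂ s) = ≢-sym (proper s)
    no-bicoloured-walk : ∀ {a b e₁ e₂ e₃ e₄} → Run e₁ e₂ e₃ e₄ ⊎ Run e₄ e₃ e₂ e₁ →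
      InTwo a b (c e₁) × InTwo a b (c e₂) × InTwo a b (c e₃) × InTwo a b (c e₄) → ⊥
    no-bicoloured-walk (inj₁ run) (c₁ , c₂ , c₃ , c₄) = no-bicoloured-run run c₁ c₂ c₃ c₄
    no-bicoloured-walk (inj₂ run) (c₁ , c₂ , c₃ , c₄) = no-bicoloured-run run c₄ c₃ c₂ c₁
    no-path : ∀ p → BicolouredPath (suc N) c p → ⊥
    no-path p (_ , _ , bicoloured) =
      no-bicoloured-walk (straight-walk s1 s2 s3 s4 d02 d13 d24) bicoloured
      where open Path4 p
    no-cycle : ∀ q → BicolouredCycle (suc N) c q → ⊥
    no-cycle q (_ , _ , bicoloured) =
      no-bicoloured-walk (straight-walk s1 s2 s3 s4 d02 d13 (≢-sym d02)) bicoloured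
      where open Cycle4 q

module WordColouring {N : ℕ} (w : List Colour) (length≡ : length w ≡ suc N) (2≤N : 2 ≤ N)
                     (cyc : CyclicWindows w) where

  colour : EdgeColouring (suc N)
  colour i = nth w (toℕ i)

  unrolled : ℕ → Colour
  unrolled t = nth (w ++ take 3 w) t

  unrolled-< : ∀ {t} → t < suc N → unrolled t ≡ nth w t
  unrolled-< t<n = nth-++ˡ w _ (subst (_ <_) (sym length≡) t<n)

  unrolled-wrap : ∀ {u} → u < 3 → unrolled (suc N + u) ≡ nth w u
  unrolled-wrap {u} u<3 = begin
    nth (w ++ take 3 w) (suc N + u)     ≡⟨ cong (λ m → unrolled (m + u)) (sym length≡) ⟩
    nth (w ++ take 3 w) (length w + u)  ≡⟨ nth-++ʳ w _ u ⟩
    nth (take 3 w) u                    ≡⟨ nth-take w u<3 ⟩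
    nth w u                             ∎
    where open ≡-Reasoning

  unrolled-step : ∀ {i j} → Succ (suc N) i j → ∀ {u} → u < 3 →
    unrolled (toℕ j + u) ≡ unrolled (toℕ i + suc u)
  unrolled-step (inj₁ j≡1+i) {u} _ = cong unrolled (trans (cong (_+ u) j≡1+i) (sym (ℕ.+-suc _ u)))
  unrolled-step {i} {j} (inj₂ (i≡N , j≡0)) {u} u<3 = begin
    unrolled (toℕ j + u)      ≡⟨ cong (λ m → unrolled (m + u)) j≡0 ⟩
    unrolled u                ≡⟨ unrolled-< (ℕ.≤-trans u<3 (s≤s 2≤N)) ⟩
    nth w u                   ≡⟨ sym (unrolled-wrap u<3) ⟩
    unrolled (suc N + u)      ≡⟨ cong unrolled (sym (trans (cong (_+ suc u) i≡N) (ℕ.+-suc N u))) ⟩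
    unrolled (toℕ i + suc u)  ∎
    where open ≡-Reasoning

  unrolled-length : length (w ++ take 3 w) ≡ suc N + 3
  unrolled-length = trans (length-++ w) (cong₂ _+_ length≡
    (trans (length-take 3 w) (ℕ.m≤n⇒m⊓n≡m (subst (3 ≤_) (sym length≡) (s≤s 2≤N)))))

  window : ∀ (i : Fin (suc N)) →
    Good (unrolled (toℕ i)) (unrolled (toℕ i + 1)) (unrolled (toℕ i + 2)) (unrolled (toℕ i + 3))
  window i = windows-nth _ (toℕ i) cyc
    (subst (toℕ i + 3 <_) (sym unrolled-length) (ℕ.+-monoˡ-< 3 (toℕ<n i)))

  colour≡ : ∀ (i : Fin (suc N)) → colour i ≡ unrolled (toℕ i)
  colour≡ i = sym (unrolled-< (toℕ<n i))

  colour-next : ∀ {i j} → Succ (suc N) i j → colour j ≡ unrolled (toℕ i + 1)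
  colour-next {j = j} s =
    trans (colour≡ j) (trans (cong unrolled (sym (ℕ.+-identityʳ _))) (unrolled-step s (s≤s z≤n)))

  locallyStar : LocallyStar (suc N) colour
  locallyStar = record { proper = proper ; no-abab = no-abab }
    where
    proper : ∀ {i j} → Succ (suc N) i j → colour i ≢ colour j
    proper {i} s = proj₁ (Good-cong (sym (colour≡ i)) (sym (colour-next s)) refl refl (window i))
    no-abab : ∀ {i j k l} → Succ (suc N) i j → Succ (suc N) j k → Succ (suc N) k l →
      colour i ≡ colour k → colour j ≢ colour l
    no-abab {i} {j} {k} {l} sij sjk skl i≡k j≡l = proj₂ (proj₂ (proj₂ good)) (i≡k , j≡l)
      where
      1<3 : 1 < 3
      1<3 = s≤s (s≤s z≤n)
      2<3 : 2 < 3
      2<3 = s≤s (s≤s (s≤s z≤n))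
      colour-k : colour k ≡ unrolled (toℕ i + 2)
      colour-k = trans (colour-next sjk) (unrolled-step sij 1<3)
      colour-l : colour l ≡ unrolled (toℕ i + 3)
      colour-l = trans (colour-next skl) (trans (unrolled-step sjk 1<3) (unrolled-step sij 2<3))
      good : Good (colour i) (colour j) (colour k) (colour l)
      good = Good-cong (sym (colour≡ i)) (sym (colour-next sij)) (sym colour-k) (sym colour-l) (window i)

-- Rotations of the cycle

module _ {N : ℕ} where

  previous : Fin (suc N) → Fin (suc N)
  previous fzero    = fromℕ N
  previous (fsuc i) = inject₁ i

  private
    below : (a : Fin N) → toℕ (inject₁ a) ≢ N
    below a a≡N = ℕ.<-irrefl (trans (sym (toℕ-inject₁ a)) a≡N) (toℕ<n a)

    below′ : (a : Fin N) → toℕ (inject₁ a) ≢ suc N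
    below′ a a≡1+N = ℕ.1+n≰n (ℕ.<⇒≤ (subst (_< N) (trans (sym (toℕ-inject₁ a)) a≡1+N) (toℕ<n a)))

  previous-succ : ∀ {a b} → Succ (suc N) a b → Succ (suc N) (previous a) (previous b)
  previous-succ {fzero}  {fzero}  (inj₂ (0≡N , _)) =
    inj₂ (toℕ-fromℕ N , trans (toℕ-fromℕ N) (sym 0≡N))
  previous-succ {fzero}  {fsuc b} (inj₁ 1+b≡1) =
    inj₂ (toℕ-fromℕ N , trans (toℕ-inject₁ b) (ℕ.suc-injective 1+b≡1))
  previous-succ {fsuc a} {fzero}  (inj₂ (1+a≡N , _)) =
    inj₁ (trans (toℕ-fromℕ N) (trans (sym 1+a≡N) (cong suc (sym (toℕ-inject₁ a)))))
  previous-succ {fsuc a} {fsuc b} (inj₁ 1+b≡2+a) =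
    inj₁ (trans (toℕ-inject₁ b) (trans (ℕ.suc-injective 1+b≡2+a) (cong suc (sym (toℕ-inject₁ a)))))

  previous-succ⁻¹ : ∀ {a b} → Succ (suc N) (previous a) (previous b) → Succ (suc N) a b
  previous-succ⁻¹ {fzero}  {fzero}  (inj₁ N≡1+N) = ⊥-elim (ℕ.1+n≢n (sym N≡1+N))
  previous-succ⁻¹ {fzero}  {fzero}  (inj₂ (_ , N≡0)) = inj₂ (trans (sym N≡0) (toℕ-fromℕ N) , refl)
  previous-succ⁻¹ {fzero}  {fsuc b} (inj₁ b≡1+N) =
    ⊥-elim (below′ b (trans b≡1+N (cong suc (toℕ-fromℕ N))))
  previous-succ⁻¹ {fzero}  {fsuc b} (inj₂ (_ , b≡0)) = inj₁ (cong suc (trans (sym (toℕ-inject₁ b)) b≡0))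
  previous-succ⁻¹ {fsuc a} {fzero}  (inj₁ N≡1+a) =
    inj₂ (trans (cong suc (sym (toℕ-inject₁ a))) (trans (sym N≡1+a) (toℕ-fromℕ N)) , refl)
  previous-succ⁻¹ {fsuc a} {fzero}  (inj₂ (a≡N , _)) = ⊥-elim (below a a≡N)
  previous-succ⁻¹ {fsuc a} {fsuc b} (inj₁ b≡1+a) =
    inj₁ (cong suc (trans (sym (toℕ-inject₁ b)) (trans b≡1+a (cong suc (toℕ-inject₁ a)))))
  previous-succ⁻¹ {fsuc a} {fsuc b} (inj₂ (a≡N , _)) = ⊥-elim (below a a≡N)

  previous-injective : ∀ {a b} → previous a ≡ previous b → a ≡ b
  previous-injective {fzero}  {fzero}  _  = refl
  previous-injective {fzero}  {fsuc b} eq = ⊥-elim (below b (trans (cong toℕ (sym eq)) (toℕ-fromℕ N)))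
  previous-injective {fsuc a} {fzero}  eq = ⊥-elim (below a (trans (cong toℕ eq) (toℕ-fromℕ N)))
  previous-injective {fsuc a} {fsuc b} eq = cong fsuc (inject₁-injective eq)

  rotate : ℕ → Fin (suc N) → Fin (suc N)
  rotate zero    a = a
  rotate (suc k) a = rotate k (previous a)

  rotate-succ : ∀ k {a b} → Succ (suc N) a b → Succ (suc N) (rotate k a) (rotate k b)
  rotate-succ zero    s = s
  rotate-succ (suc k) s = rotate-succ k (previous-succ s)

  rotate-succ⁻¹ : ∀ k {a b} → Succ (suc N) (rotate k a) (rotate k b) → Succ (suc N) a b
  rotate-succ⁻¹ zero    s = s
  rotate-succ⁻¹ (suc k) s = previous-succ⁻¹ (rotate-succ⁻¹ k s)

  rotate-injective : ∀ k {a b} → rotate k a ≡ rotate k b → a ≡ b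
  rotate-injective zero    eq = eq
  rotate-injective (suc k) eq = previous-injective (rotate-injective k eq)

  rotate-to-zero : ∀ k a → toℕ a ≡ k → rotate k a ≡ fzero
  rotate-to-zero zero    a        a≡0   = toℕ-injective a≡0
  rotate-to-zero (suc k) (fsuc a) a≡1+k =
    rotate-to-zero k (inject₁ a) (trans (toℕ-inject₁ a) (ℕ.suc-injective a≡1+k))

-- Extending the precolouring

≢0∧≢1⇒2≤ : ∀ {m} → m ≢ 0 → m ≢ 1 → 2 ≤ m
≢0∧≢1⇒2≤ {zero}        m≢0 _   = ⊥-elim (m≢0 refl)
≢0∧≢1⇒2≤ {suc zero}    _   m≢1 = ⊥-elim (m≢1 refl)
≢0∧≢1⇒2≤ {suc (suc _)} _   _   = s≤s (s≤s z≤n)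

-- gap₁ and gap₂ count the edges strictly between y and z and strictly between z and x.
record Placement {N : ℕ} (x y z : Fin (suc N)) : Set where
  field
    rotation      : Fin (suc N) → Fin (suc N)
    rotation-succ : ∀ {i j} → Succ (suc N) i j → Succ (suc N) (rotation i) (rotation j)
    gap₁ gap₂     : ℕ
    size          : suc N ≡ 3 + (gap₁ + gap₂)
    at-x          : toℕ (rotation x) ≡ 0
    at-y          : toℕ (rotation y) ≡ 1
    at-z          : toℕ (rotation z) ≡ 2 + gap₁
    gap₁≡0⇒       : gap₁ ≡ 0 → Succ (suc N) y z
    gap₂≡0⇒       : gap₂ ≡ 0 → Succ (suc N) z x

placement : ∀ {N} {x y z : Fin (suc N)} → 2 ≤ N → Succ (suc N) x y → z ≢ x → z ≢ y → Placement x y z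
placement {N} {x} {y} {z} 2≤N x→y z≢x z≢y = record
  { rotation      = r
  ; rotation-succ = rotate-succ (toℕ x)
  ; gap₁          = p
  ; gap₂          = q
  ; size          = trans (sym 1+d+q≡n) (cong (λ m → suc m + q) (sym 2+p≡d))
  ; at-x          = cong toℕ rx≡0
  ; at-y          = ry≡1
  ; at-z          = sym 2+p≡d
  ; gap₁≡0⇒       = λ p≡0 → rotate-succ⁻¹ (toℕ x)
                      (inj₁ (trans (sym 2+p≡d) (trans (cong (2 +_) p≡0) (cong suc (sym ry≡1)))))
  ; gap₂≡0⇒       = λ q≡0 → rotate-succ⁻¹ (toℕ x) (inj₂ (d≡N q≡0 , cong toℕ rx≡0))
  }
  where
  r : Fin (suc N) → Fin (suc N)
  r = rotate (toℕ x)
  rx≡0 : r x ≡ fzero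
  rx≡0 = rotate-to-zero (toℕ x) x refl
  ry≡1 : toℕ (r y) ≡ 1
  ry≡1 with subst (λ a → Succ (suc N) a (r y)) rx≡0 (rotate-succ (toℕ x) x→y)
  ... | inj₁ ry≡1      = ry≡1
  ... | inj₂ (0≡N , _) = ⊥-elim (ℕ.<⇒≱ 2≤N (subst (_≤ 1) 0≡N z≤n))
  d : ℕ
  d = toℕ (r z)
  2≤d : 2 ≤ d
  2≤d = ≢0∧≢1⇒2≤ (λ d≡0 → z≢x (rotate-injective (toℕ x) (trans (toℕ-injective d≡0) (sym rx≡0))))
                  (λ d≡1 → z≢y (rotate-injective (toℕ x) (toℕ-injective (trans d≡1 (sym ry≡1)))))
  p : ℕ
  p = proj₁ (ℕ.m≤n⇒∃[o]m+o≡n 2≤d)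
  2+p≡d : 2 + p ≡ d
  2+p≡d = proj₂ (ℕ.m≤n⇒∃[o]m+o≡n 2≤d)
  q : ℕ
  q = proj₁ (ℕ.m≤n⇒∃[o]m+o≡n (toℕ<n (r z)))
  1+d+q≡n : suc d + q ≡ suc N
  1+d+q≡n = proj₂ (ℕ.m≤n⇒∃[o]m+o≡n (toℕ<n (r z)))
  d≡N : q ≡ 0 → d ≡ N
  d≡N q≡0 = ℕ.suc-injective (trans (sym (ℕ.+-identityʳ _)) (trans (cong (suc d +_) (sym q≡0)) 1+d+q≡n))

Extension : (n : ℕ) → Fin n → Fin n → Fin n → Colour → Colour → Colour → Set
Extension n e₁ e₂ e₃ k₁ k₂ k₃ =
  Σ (EdgeColouring n) λ c → StarColouring3 n c × c e₁ ≡ k₁ × c e₂ ≡ k₂ × c e₃ ≡ k₃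

extend-from-successor : ∀ {N} → 2 ≤ N → suc N ≢ 5 → ∀ {x y z : Fin (suc N)} {kx ky kz} →
  Succ (suc N) x y → z ≢ x → z ≢ y → kx ≢ ky →
  (AdjEdges (suc N) x z → kx ≢ kz) → (AdjEdges (suc N) y z → ky ≢ kz) → Extension (suc N) x y z kx ky kz
extend-from-successor {N} 2≤N n≢5 {x} {y} {z} {kx} {ky} {kz} x→y z≢x z≢y kx≢ky x-z y-z =
  extension (star-word feasible)
  where
  open Placement (placement 2≤N x→y z≢x z≢y)
  feasible : Feasible kx ky gap₁ gap₂ kz
  feasible = kx≢ky , (λ gaps≡2 → n≢5 (trans size (cong (3 +_) gaps≡2))) ,
             (λ gap₁≡0 → ≢-sym (y-z (inj₁ (gap₁≡0⇒ gap₁≡0)))) ,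
             (λ gap₂≡0 → ≢-sym (x-z (inj₂ (gap₂≡0⇒ gap₂≡0))))
  extension : StarWord kx ky gap₁ gap₂ kz → Extension (suc N) x y z kx ky kz
  extension (u , length≡ , cyc , at-gap₁) =
    (λ i → colour (rotation i)) ,
    locallyStar⇒star (locallyStar-∘ rotation rotation-succ locallyStar) ,
    cong (nth w) at-x , cong (nth w) at-y , trans (cong (nth w) at-z) at-gap₁
    where
    w : List Colour
    w = kx ∷ ky ∷ u
    open WordColouring w (trans (cong (2 +_) length≡) (sym size)) 2≤N cyc

extend-from-adjacent : ∀ {N} → 2 ≤ N → suc N ≢ 5 → ∀ {x y z : Fin (suc N)} {kx ky kz} →
  AdjEdges (suc N) x y → z ≢ x → z ≢ y → kx ≢ ky →
  (AdjEdges (suc N) x z → kx ≢ kz) → (AdjEdges (suc N) y z → ky ≢ kz) → Extension (suc N) x y z kx ky kz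
extend-from-adjacent 2≤N n≢5 (inj₁ x→y) z≢x z≢y kx≢ky x-z y-z =
  extend-from-successor 2≤N n≢5 x→y z≢x z≢y kx≢ky x-z y-z
extend-from-adjacent 2≤N n≢5 (inj₂ y→x) z≢x z≢y kx≢ky x-z y-z =
  let c , star , cy , cx , cz = extend-from-successor 2≤N n≢5 y→x z≢y z≢x (≢-sym kx≢ky) y-z x-z in
  c , star , cx , cy , cz

flip-adjacent : ∀ {n} {e e′ : Fin n} {k k′ : Colour} →
  (AdjEdges n e e′ → k ≢ k′) → AdjEdges n e′ e → k′ ≢ k
flip-adjacent clash (inj₁ s) = ≢-sym (clash (inj₂ s))
flip-adjacent clash (inj₂ s) = ≢-sym (clash (inj₁ s))

lemma3 : (n : ℕ) → 3 ≤ n → n ≢ 5 →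
    (e₁ e₂ e₃ : Fin n) → e₁ ≢ e₂ → e₁ ≢ e₃ → e₂ ≢ e₃ →
    (k₁ k₂ k₃ : Colour) →
    (AdjEdges n e₁ e₂ → k₁ ≢ k₂) →
    (AdjEdges n e₁ e₃ → k₁ ≢ k₃) →
    (AdjEdges n e₂ e₃ → k₂ ≢ k₃) →
    (AdjEdges n e₁ e₂ ⊎ AdjEdges n e₁ e₃ ⊎ AdjEdges n e₂ e₃) →
    Σ (EdgeColouring n) (λ c →
      StarColouring3 n c × c e₁ ≡ k₁ × c e₂ ≡ k₂ × c e₃ ≡ k₃)
lemma3 (suc N) (s≤s 2≤N) n≢5 _ _ _ _ d₁₃ d₂₃ _ _ _ c₁₂ c₁₃ c₂₃ (inj₁ a₁₂) =
  extend-from-adjacent 2≤N n≢5 a₁₂ (≢-sym d₁₃) (≢-sym d₂₃) (c₁₂ a₁₂) c₁₃ c₂₃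
lemma3 (suc N) (s≤s 2≤N) n≢5 _ _ _ d₁₂ _ d₂₃ _ _ _ c₁₂ c₁₃ c₂₃ (inj₂ (inj₁ a₁₃)) =
  let c , star , c₁ , c₃ , c₂ =
        extend-from-adjacent 2≤N n≢5 a₁₃ (≢-sym d₁₂) d₂₃ (c₁₃ a₁₃) c₁₂ (flip-adjacent c₂₃) in
  c , star , c₁ , c₂ , c₃
lemma3 (suc N) (s≤s 2≤N) n≢5 _ _ _ d₁₂ d₁₃ _ _ _ _ c₁₂ c₁₃ c₂₃ (inj₂ (inj₂ a₂₃)) =
  let c , star , c₂ , c₃ , c₁ =
        extend-from-adjacent 2≤N n≢5 a₂₃ d₁₂ d₁₃ (c₂₃ a₂₃) (flip-adjacent c₁₂) (flip-adjacent c₁₃) in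
  c , star , c₁ , c₂ , c₃
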